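{- Let $\chi\in\{0,1\}^n$ be an unknown binary string of known length $n$, accessible only through substring queries $Q(X)$, where $Q(X)=1$ if $X$ is a substring (contiguous factor) of $\chi$ and $Q(X)=0$ otherwise. Let $S$ be a binary string that is a substring of $\chi$ and $T$ a nonempty binary string that is not a substring of $\chi$. Then the procedure $\textsc{Basic}(S,T)$ described in the context always outputs $\chi$, and the number of queries it makes is $n-|S|+|T|+1$.
   Context: Notation: for a symbol $s\in\{0,1\}$, $\overline{s}=1-s$; $T[i]$ is the $i$-th symbol of $T$; juxtaposition denotes concatenation; $|X|$ is the length of $X$. The procedure $\textsc{Basic}(S,T)$ is as follows. Phase 1: set $i\leftarrow 1$. While $i\le |T|$: if $Q(S\,T[1]\cdots T[i-1]\,\overline{T[i]})=1$ then set $S\leftarrow S\,T[1]\cdots T[i-1]\,\overline{T[i]}$ and $i\leftarrow 1$; otherwise set $i\leftarrow i+1$. Phase 2: set $i\leftarrow 1$. While $Q(S\,T[i])=1$: set $S\leftarrow S\,T[i]$ and $i\leftarrow i+1$. Phase 3: while $|S|<n$: if $Q(1S)=1$ then $S\leftarrow 1S$, else $S\leftarrow 0S$. Return $S$. -}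

module Defs where

open import Data.Bool using (Bool; true; false; not)
open import Data.Nat using (ℕ; zero; suc; _≤_; _<_)
open import Data.List using (List; []; _∷_; _++_; [_]; length; take; lookup)
open import Data.Fin using (fromℕ<)
open import Data.List.Relation.Binary.Infix.Heterogeneous using (Infix)
open import Relation.Binary.PropositionalEquality using (_≡_)
open import Relation.Nullary using (¬_)

-- Binary strings are lists of booleans (false = 0, true = 1).
BinStr : Set
BinStr = List Bool

-- X is a substring (contiguous factor) of Y.
-- The oracle answer Q(X) = 1 iff  Substring X χ.
Substring : BinStr → BinStr → Set
Substring X Y = Infix _≡_ X Y

-- Big-step operational semantics of Basic(S,T) run against the oracle
-- for the hidden string χ (with n = length χ).
-- Each judgement  Phase… args out k  means: from this state the procedure
-- terminates, returns `out`, and makes exactly k further queries.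
module Basic (χ : BinStr) (T : BinStr) where

  -- The string  T[1] ⋯ T[i-1] ¬T[i]   for 1-based i = j+1 (here j is 0-based).
  flipAt : (j : ℕ) → j < length T → BinStr
  flipAt j p = take j T ++ [ not (lookup T (fromℕ< p)) ]

  data Phase3 : BinStr → BinStr → ℕ → Set where
    p3-done : ∀ {S} → length χ ≤ length S → Phase3 S S 0
    p3-one  : ∀ {S out k} → length S < length χ →
              Substring (true ∷ S) χ →
              Phase3 (true ∷ S) out k → Phase3 S out (suc k)
    p3-zero : ∀ {S out k} → length S < length χ →
              ¬ Substring (true ∷ S) χ →
              Phase3 (false ∷ S) out k → Phase3 S out (suc k)

  -- Phase 2: the second argument is the not-yet-used suffix
  -- T[i] T[i+1] ⋯ of T.  While Q(S T[i]) = 1, append T[i].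
  -- (If the suffix runs out, T[i] is undefined and no rule applies.)
  data Phase2 : BinStr → BinStr → BinStr → ℕ → Set where
    p2-yes : ∀ {S t R out k} → Substring (S ++ [ t ]) χ →
             Phase2 (S ++ [ t ]) R out k → Phase2 S (t ∷ R) out (suc k)
    p2-no  : ∀ {S t R out k} → ¬ Substring (S ++ [ t ]) χ →
             Phase3 S out k → Phase2 S (t ∷ R) out (suc k)

  -- Phase 1 with 0-based index j (the paper's i is j+1).
  data Phase1 : BinStr → ℕ → BinStr → ℕ → Set where
    p1-yes  : ∀ {S j out k} (p : j < length T) →
              Substring (S ++ flipAt j p) χ →
              Phase1 (S ++ flipAt j p) 0 out k → Phase1 S j out (suc k)
    p1-no   : ∀ {S j out k} (p : j < length T) →
              ¬ Substring (S ++ flipAt j p) χ →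
              Phase1 S (suc j) out k → Phase1 S j out (suc k)
    p1-done : ∀ {S j out k} → length T ≤ j →
              Phase2 S T out k → Phase1 S j out k

BasicRun : BinStr → BinStr → BinStr → BinStr → ℕ → Set
BasicRun χ S T out k = Basic.Phase1 χ T S 0 out k

-- Phase 1 keeps S a factor of χ, and when it reaches position j all the
-- queries S T[1..i-1] ¬T[i] with i < j have been rejected. Phase 2 then walks
-- along T from S; as T is not a factor it stops at some S T[1..i-1] whose
-- extension by T[i] is absent, while its extension by ¬T[i] was rejected in
-- Phase 1. A factor with no right extension is a suffix of χ, and so is each
-- left extension of it that is a factor; hence Phase 3 rebuilds χ.
-- Every Phase-1 query raises |S| + j by one, from |S₀| to |S₁| + |T|;
-- Phase 2 asks |S₂| - |S₁| + 1 queries and Phase 3 asks n - |S₂|.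

module Submission where

open import Defs
open import Data.Bool using (true; false; not)
import Data.Bool.Properties as Bool
open import Data.Nat using (ℕ; zero; suc; _+_; _∸_; _≤_; _<_; z≤n; s≤s; _⊓_; _<?_; _≤?_)
open import Data.Nat.Properties
  using (+-suc; +-comm; +-assoc; +-identityʳ; +-∸-comm; m+n∸n≡m; ≤-trans; ≤-antisym;
         m≤m+n; <⇒≢; <⇒≤; <⇒≱; ≰⇒>; ≮⇒≥; m≤n⇒m⊓n≡m; +-mono-≤-<; m<1+n⇒m<n∨m≡n)
open import Data.List using (List; []; _∷_; _++_; [_]; length; take)
open import Data.List.Properties using (length-++; length-take; ++-assoc; ++-identityʳ)
open import Data.List.Relation.Binary.Pointwise
  using (_∷_; Pointwise-length; Pointwise-≡⇒≡; ≡⇒Pointwise-≡)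
open import Data.List.Relation.Binary.Prefix.Heterogeneous using (Prefix; []; _∷_)
open import Data.List.Relation.Binary.Suffix.Heterogeneous using (Suffix; here; there)
import Data.List.Relation.Binary.Suffix.Heterogeneous.Properties as Suffix
open import Data.List.Relation.Binary.Infix.Heterogeneous using (Infix; here; there; _++ⁱ_)
open import Data.List.Relation.Binary.Infix.Heterogeneous.Properties
  using (fromPointwise; fromSuffix; length-mono; infix?)
import Data.List.Relation.Binary.Infix.Heterogeneous.Properties as Infix
open import Data.Product using (Σ; ∃; _×_; _,_; proj₁; proj₂; map₂)
open import Data.Sum using (inj₁; inj₂)
open import Function using (_∘_; id)
open import Relation.Binary.PropositionalEquality
  using (_≡_; _≢_; refl; sym; trans; cong; subst; module ≡-Reasoning)
open import Relation.Nullary using (¬_; Dec; yes; no; contradiction)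

module _ {a} {A : Set a} where

  infix-refl : (xs : List A) → Infix _≡_ xs xs
  infix-refl xs = fromPointwise (≡⇒Pointwise-≡ refl)

  infix-trans : {xs ys zs : List A} → Infix _≡_ xs ys → Infix _≡_ ys zs → Infix _≡_ xs zs
  infix-trans = Infix.trans trans

  infix-++⁻ʳ : (xs : List A) {ys zs : List A} → Infix _≡_ (xs ++ ys) zs → Infix _≡_ ys zs
  infix-++⁻ʳ xs {ys} = infix-trans (xs ++ⁱ infix-refl ys)

  prefix-unextendable⇒≡ : {xs ys : List A} → Prefix _≡_ xs ys →
                          (∀ y → ¬ Prefix _≡_ (xs ++ [ y ]) ys) → xs ≡ ys
  prefix-unextendable⇒≡ {ys = []}    []         _  = refl
  prefix-unextendable⇒≡ {ys = y ∷ _} []         ne = contradiction (refl ∷ []) (ne y)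
  prefix-unextendable⇒≡              (refl ∷ p) ne =
    cong (_ ∷_) (prefix-unextendable⇒≡ p (λ y q → ne y (refl ∷ q)))

  infix-unextendable⇒suffix : {xs ys : List A} → Infix _≡_ xs ys →
                              (∀ y → ¬ Infix _≡_ (xs ++ [ y ]) ys) → Suffix _≡_ xs ys
  infix-unextendable⇒suffix (here p)  ne =
    here (≡⇒Pointwise-≡ (prefix-unextendable⇒≡ p (λ y q → ne y (here q))))
  infix-unextendable⇒suffix (there i) ne =
    there (infix-unextendable⇒suffix i (λ y q → ne y (there q)))

  suffix-∷-extend : {xs ys : List A} → Suffix _≡_ xs ys → length xs < length ys →
                    ∃ λ y → Suffix _≡_ (y ∷ xs) ys
  suffix-∷-extend (here eq) lt = contradiction (Pointwise-length eq) (<⇒≢ lt)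
  suffix-∷-extend {ys = y ∷ _} (there (here eq)) _ = y , here (refl ∷ eq)
  suffix-∷-extend (there s@(there s′)) _ =
    map₂ there (suffix-∷-extend s (s≤s (Suffix.length-mono s′)))

  suffix-length-≥⇒≡ : {xs ys : List A} → Suffix _≡_ xs ys → length ys ≤ length xs → xs ≡ ys
  suffix-length-≥⇒≡ s le =
    Pointwise-≡⇒≡ (Suffix.toPointwise (≤-antisym (Suffix.length-mono s) le) s)

  length-∷ʳ : (xs : List A) (x : A) → length (xs ++ [ x ]) ≡ suc (length xs)
  length-∷ʳ xs x = trans (length-++ xs) (+-comm (length xs) 1)

k+1+m≡n⇒1+k+m≡n : ∀ {k m n} → k + suc m ≡ n → suc k + m ≡ n
k+1+m≡n⇒1+k+m≡n {k} {m} = trans (sym (+-suc k m))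

≤-suc-+⇒≤-+-suc : ∀ {m} d x → m ≤ suc d + x → m ≤ d + suc x
≤-suc-+⇒≤-+-suc {m} d x = subst (m ≤_) (sym (+-suc d x))

k+s≡1+n+t⇒k≡n∸s+t+1 : ∀ {k s n t} → s ≤ n → k + s ≡ suc (n + t) → k ≡ n ∸ s + t + 1
k+s≡1+n+t⇒k≡n∸s+t+1 {k} {s} {n} {t} s≤n eq = begin
  k                  ≡⟨ sym (m+n∸n≡m k s) ⟩
  k + s ∸ s          ≡⟨ cong (_∸ s) eq ⟩
  suc (n + t) ∸ s    ≡⟨ cong (_∸ s) (+-comm 1 (n + t)) ⟩
  n + t + 1 ∸ s      ≡⟨ +-∸-comm 1 (≤-trans s≤n (m≤m+n n t)) ⟩
  n + t ∸ s + 1      ≡⟨ cong (_+ 1) (+-∸-comm t s≤n) ⟩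
  n ∸ s + t + 1      ∎
  where open ≡-Reasoning

substring? : (X Y : BinStr) → Dec (Substring X Y)
substring? = infix? Bool._≟_

Halts : (BinStr → ℕ → Set) → Set
Halts Run = Σ BinStr λ out → Σ ℕ (Run out)

halts-map : ∀ {P Q : BinStr → ℕ → Set} (f : ℕ → ℕ) →
            (∀ {out k} → P out k → Q out (f k)) → Halts P → Halts Q
halts-map f step (out , k , run) = out , f k , step run

NoRightExtension : BinStr → BinStr → Set
NoRightExtension χ S = ∀ b → ¬ Substring (S ++ [ b ]) χ

noRightExtension-∷ : ∀ {χ S} b → NoRightExtension χ S → NoRightExtension χ (b ∷ S)
noRightExtension-∷ b ne c = ne c ∘ infix-++⁻ʳ [ b ]

noRightExtension-both : ∀ {χ S} t → ¬ Substring (S ++ [ t ]) χ →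
                        ¬ Substring (S ++ [ not t ]) χ → NoRightExtension χ S
noRightExtension-both true  ¬St _    true  = ¬St
noRightExtension-both true  _   ¬St̄ false = ¬St̄
noRightExtension-both false _   ¬St̄ true  = ¬St̄
noRightExtension-both false ¬St _    false = ¬St

FlipsRejected : (χ S R : BinStr) → ℕ → Set
FlipsRejected χ S R j =
  ∀ i (p : i < length R) → i < j → ¬ Substring (S ++ Basic.flipAt χ R i p) χ

module _ {χ S : BinStr} where

  flipsRejected-suc : ∀ {R j} (p : j < length R) → FlipsRejected χ S R j →
                      ¬ Substring (S ++ Basic.flipAt χ R j p) χ → FlipsRejected χ S R (suc j)
  flipsRejected-suc p rejected ¬flip i q i<1+j with m<1+n⇒m<n∨m≡n i<1+j
  ... | inj₁ i<j  = rejected i q i<j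
  ... | inj₂ refl = ¬flip

  flipsRejected-∷ : ∀ {t R} → FlipsRejected χ S (t ∷ R) (suc (length R)) →
                    ¬ Substring (S ++ [ not t ]) χ × FlipsRejected χ (S ++ [ t ]) R (length R)
  flipsRejected-∷ {t} rejected =
    rejected 0 (s≤s z≤n) (s≤s z≤n) ,
    λ i p i<∣R∣ → rejected (suc i) (s≤s p) (s≤s i<∣R∣)
                  ∘ subst (λ X → Substring X χ) (++-assoc S [ t ] _)

module Correctness (χ T : BinStr) where
  open Basic χ T

  n : ℕ
  n = length χ

  length-++-flipAt : ∀ S j (p : j < length T) → length (S ++ flipAt j p) ≡ suc (length S + j)
  length-++-flipAt S j p = begin
    length (S ++ flipAt j p)           ≡⟨ length-++ S ⟩
    length S + length (flipAt j p)     ≡⟨ cong (length S +_) (length-∷ʳ (take j T) _) ⟩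
    length S + suc (length (take j T)) ≡⟨ cong (λ x → length S + suc x) (length-take j T) ⟩
    length S + suc (j ⊓ length T)      ≡⟨ cong (λ x → length S + suc x) (m≤n⇒m⊓n≡m (<⇒≤ p)) ⟩
    length S + suc j                   ≡⟨ +-suc (length S) j ⟩
    suc (length S + j)                 ∎
    where open ≡-Reasoning

  phase3-correct : ∀ {S out k} → Phase3 S out k → Substring S χ → NoRightExtension χ S →
                   out ≡ χ × k + length S ≡ n
  phase3-correct (p3-done n≤∣S∣) S∈χ ne =
    let S≡χ = suffix-length-≥⇒≡ (infix-unextendable⇒suffix S∈χ ne) n≤∣S∣
    in  S≡χ , cong length S≡χ
  phase3-correct (p3-one _ 1S∈χ run) _ ne =
    map₂ k+1+m≡n⇒1+k+m≡n (phase3-correct run 1S∈χ (noRightExtension-∷ true ne))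
  phase3-correct (p3-zero ∣S∣<n 1S∉χ run) S∈χ ne
    with suffix-∷-extend (infix-unextendable⇒suffix S∈χ ne) ∣S∣<n
  ... | true  , 1S-suffix = contradiction (fromSuffix 1S-suffix) 1S∉χ
  ... | false , 0S-suffix =
    map₂ k+1+m≡n⇒1+k+m≡n
         (phase3-correct run (fromSuffix 0S-suffix) (noRightExtension-∷ false ne))

  phase3-halts : ∀ d S → n ≤ d + length S → Halts (Phase3 S)
  phase3-halts d S fuel with n ≤? length S
  ... | yes n≤∣S∣ = S , 0 , p3-done n≤∣S∣
  phase3-halts zero    S fuel | no n≰∣S∣ = contradiction fuel n≰∣S∣
  phase3-halts (suc d) S fuel | no n≰∣S∣ with substring? (true ∷ S) χ
  ... | yes 1S∈χ =
    halts-map suc (p3-one (≰⇒> n≰∣S∣) 1S∈χ)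
                  (phase3-halts d _ (≤-suc-+⇒≤-+-suc d _ fuel))
  ... | no  1S∉χ =
    halts-map suc (p3-zero (≰⇒> n≰∣S∣) 1S∉χ)
                  (phase3-halts d _ (≤-suc-+⇒≤-+-suc d _ fuel))

  phase2-correct : ∀ {S R out k} → Phase2 S R out k → Substring S χ →
                   FlipsRejected χ S R (length R) → out ≡ χ × k + length S ≡ suc n
  phase2-correct {S} (p2-yes {t = t} {k = k} St∈χ run) _ rejected =
    map₂ (k+1+m≡n⇒1+k+m≡n ∘ trans (cong (k +_) (sym (length-∷ʳ S t))))
         (phase2-correct run St∈χ (proj₂ (flipsRejected-∷ {S = S} rejected)))
  phase2-correct {S} (p2-no {t = t} St∉χ run) S∈χ rejected =
    map₂ (cong suc) (phase3-correct run S∈χ no-extension)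
    where
    no-extension : NoRightExtension χ S
    no-extension = noRightExtension-both t St∉χ (proj₁ (flipsRejected-∷ {S = S} rejected))

  phase2-halts : ∀ S R → Substring S χ → ¬ Substring (S ++ R) χ → Halts (Phase2 S R)
  phase2-halts S []      S∈χ S∉χ =
    contradiction (subst (λ X → Substring X χ) (sym (++-identityʳ S)) S∈χ) S∉χ
  phase2-halts S (t ∷ R) _   StR∉χ with substring? (S ++ [ t ]) χ
  ... | yes St∈χ = halts-map suc (p2-yes St∈χ) (phase2-halts _ R St∈χ StR∉χ′)
    where
    StR∉χ′ : ¬ Substring ((S ++ [ t ]) ++ R) χ
    StR∉χ′ = StR∉χ ∘ subst (λ X → Substring X χ) (++-assoc S [ t ] R)
  ... | no  St∉χ = halts-map suc (p2-no St∉χ) (phase3-halts n S (m≤m+n n (length S)))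

  phase1-correct : ∀ {S j out k} → Phase1 S j out k → Substring S χ → j ≤ length T →
                   FlipsRejected χ S T j → out ≡ χ × k + (length S + j) ≡ suc (n + length T)
  phase1-correct {S} {j} (p1-yes {k = k} p SF∈χ run) _ _ _ =
    map₂ (k+1+m≡n⇒1+k+m≡n ∘ trans (cong (k +_) (sym ∣SF∣+0)))
         (phase1-correct run SF∈χ z≤n (λ _ _ ()))
    where
    ∣SF∣+0 : length (S ++ flipAt j p) + 0 ≡ suc (length S + j)
    ∣SF∣+0 = trans (+-identityʳ _) (length-++-flipAt S j p)
  phase1-correct {S} {j} (p1-no {k = k} p SF∉χ run) S∈χ _ rejected =
    map₂ (k+1+m≡n⇒1+k+m≡n ∘ trans (cong (k +_) (sym (+-suc (length S) j))))
         (phase1-correct run S∈χ p (flipsRejected-suc {S = S} {R = T} p rejected SF∉χ))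
  phase1-correct {S} {j} (p1-done {k = k} ∣T∣≤j run) S∈χ j≤∣T∣ rejected
    with refl ← ≤-antisym j≤∣T∣ ∣T∣≤j =
    map₂ (trans (sym (+-assoc k (length S) j)) ∘ cong (_+ j))
         (phase2-correct run S∈χ (λ i p _ → rejected i p p))

  phase1-halts : ∀ d S j → n + length T ≤ d + (length S + j) → Substring S χ →
                 ¬ Substring T χ → Halts (Phase1 S j)
  phase1-halts d S j fuel S∈χ T∉χ with j <? length T
  ... | no j≮∣T∣ =
    halts-map id (p1-done (≮⇒≥ j≮∣T∣)) (phase2-halts S T S∈χ (T∉χ ∘ infix-++⁻ʳ S))
  phase1-halts zero    S j fuel S∈χ T∉χ | yes p =
    contradiction fuel (<⇒≱ (+-mono-≤-< (length-mono S∈χ) p))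
  phase1-halts (suc d) S j fuel S∈χ T∉χ | yes p with substring? (S ++ flipAt j p) χ
  ... | yes SF∈χ = halts-map suc (p1-yes p SF∈χ) (phase1-halts d _ 0 fuel′ SF∈χ T∉χ)
    where
    fuel′ : n + length T ≤ d + (length (S ++ flipAt j p) + 0)
    fuel′ = subst (λ x → n + length T ≤ d + x)
                  (sym (trans (+-identityʳ _) (length-++-flipAt S j p)))
                  (≤-suc-+⇒≤-+-suc d _ fuel)
  ... | no  SF∉χ = halts-map suc (p1-no p SF∉χ) (phase1-halts d S (suc j) fuel′ S∈χ T∉χ)
    where
    fuel′ : n + length T ≤ d + (length S + suc j)
    fuel′ = subst (λ x → n + length T ≤ d + x) (sym (+-suc (length S) j))
                  (≤-suc-+⇒≤-+-suc d _ fuel)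

theorem1 : (χ S T : BinStr) → Substring S χ → T ≢ [] → ¬ Substring T χ →
    (Σ BinStr λ out → Σ ℕ λ k → BasicRun χ S T out k)
    × ((out : BinStr) (k : ℕ) → BasicRun χ S T out k →
       (out ≡ χ) × (k ≡ (length χ ∸ length S) + length T + 1))
-- T ≢ [] already follows from ¬ Substring T χ, as [] is a factor of every string.
theorem1 χ S T S∈χ _ T∉χ =
  phase1-halts (length χ + length T) S 0 (m≤m+n _ _) S∈χ T∉χ ,
  λ out k run →
    map₂ (k+s≡1+n+t⇒k≡n∸s+t+1 (length-mono S∈χ)
          ∘ trans (cong (k +_) (sym (+-identityʳ _))))
         (phase1-correct run S∈χ z≤n (λ _ _ ()))
  where open Correctness χ T
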